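{- For every fixed integer $d\ge 1$ there exists a constant $C_d$ such that for every integer $n\ge 1$ there is a graph $\mathcal{U}$ with at most $C_d\, n$ nodes that is universal for $\mathcal{F}(n,d)$, i.e., every forest in $\mathcal{F}(n,d)$ (viewed as an undirected graph) is an induced subgraph of $\mathcal{U}$.
   Context: A rooted forest is a collection of rooted trees. The depth of a node $u$ in a rooted tree is $1$ plus the hop distance from $u$ to the root; the depth of a forest is the maximum depth of its nodes. $\mathcal{F}(n,d)$ denotes the family of all rooted forests with at most $n$ nodes and depth at most $d$. A graph $G$ is an induced subgraph of a graph $\mathcal{U}$ if there is an injective map $\phi:V(G)\to V(\mathcal{U})$ such that for all $u,v\in V(G)$, $\{u,v\}\in E(G)$ if and only if $\{\phi(u),\phi(v)\}\in E(\mathcal{U})$. A graph $\mathcal{U}$ is universal for a family $\mathcal{G}$ if every graph in $\mathcal{G}$ is an induced subgraph of $\mathcal{U}$. -}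

module Defs where

open import Data.Nat using (ℕ; zero; suc)
open import Data.Fin using (Fin)
open import Data.Maybe using (Maybe; just; nothing)
open import Data.Product using (Σ; _×_; _,_)
open import Data.Sum using (_⊎_)
open import Data.Empty using (⊥)
open import Relation.Binary.PropositionalEquality using (_≡_)
open import Relation.Nullary using (¬_)
open import Function.Definitions using (Injective)
open import Function.Bundles using (_⇔_)

record Graph (N : ℕ) : Set₁ where
  field
    Adj   : Fin N → Fin N → Set
    sym   : ∀ {u v} → Adj u v → Adj v u
    irrefl : ∀ {u} → ¬ Adj u u
open Graph public

-- A rooted forest on node set Fin m is given by a parent map:
-- parent u ≡ nothing  iff u is a root.
ParentMap : ℕ → Set
ParentMap m = Fin m → Maybe (Fin m)

-- DepthAtMost p k u : the depth of u (1 + hop distance to its root) is ≤ k.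
-- (This also forces the parent chain from u to end in a root, i.e. no cycles.)
DepthAtMost : ∀ {m} → ParentMap m → ℕ → Fin m → Set
DepthAtMost p zero    u = ⊥
DepthAtMost p (suc k) u = (p u ≡ nothing) ⊎ Σ _ (λ v → (p u ≡ just v) × DepthAtMost p k v)

record Forest (m d : ℕ) : Set where
  field
    parent : ParentMap m
    depth≤ : ∀ u → DepthAtMost parent d u
open Forest public

ForestAdj : ∀ {m d} → Forest m d → Fin m → Fin m → Set
ForestAdj F u v = (parent F u ≡ just v) ⊎ (parent F v ≡ just u)

IsInducedSubgraph : ∀ {m N} → (Fin m → Fin m → Set) → Graph N → Set
IsInducedSubgraph {m} {N} E U =
  Σ (Fin m → Fin N) (λ φ → Injective _≡_ _≡_ φ × (∀ u v → E u v ⇔ Adj U (φ u) (φ v)))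

Universal : ∀ {N} → ℕ → ℕ → Graph N → Set
Universal n d U = ∀ m → m Data.Nat.≤ n → (F : Forest m d) → IsInducedSubgraph (ForestAdj F) U

module Submission where

-- A vertex of U d M is a pair (level k < d, aligned block [s, s + 2^e) ⊆ [0, M)), adjacent
-- to the vertices one level lower whose block lies inside its own; aligned blocks are
-- encoded injectively by the numbers 2s + 2^e ≤ 2M, which gives the vertex count.  A forest
-- embeds as soon as it has an interval model: roots on level 0, children one level lower
-- inside their parent's block, distinct nodes of one level on apart blocks.  Such a model
-- is built by packing the blocks of the children of each node greedily (each aligned to its
-- own length) into a block whose length is the next power of two; the total block length
-- then grows by at most a factor 5 per level, so all blocks fit into [0, 2 · 5^(d-1) · n).
-- In order: finite sums, powers of two, intervals and aligned packing, the graph U and the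
-- embedding of interval models, the layout of a forest with its size bound, the theorem.

open import Defs hiding (sym)
open import Data.Nat using (ℕ; zero; suc; _+_; _*_; _∸_; _^_; _≤_; _<_; z≤n; s≤s; pred; _≤?_; NonZero)
open import Data.Nat.Properties
open import Data.Nat.DivMod using (_/_; _%_; m≡m%n+[m/n]*n; m%n<n; m/n*n≤m)
open import Data.Nat.Divisibility
  using (_∣_; n∣m*n; m∣m*n; ∣-trans; *-monoʳ-∣; ∣m∣n⇒∣m+n; ∣m+n∣m⇒∣n; ∣⇒≤)
open import Data.Fin using (Fin; zero; suc; toℕ; fromℕ<; combine; remQuot)
open import Data.Fin.Properties using (toℕ-fromℕ<; remQuot-combine) renaming (_≟_ to _≟ᶠ_; suc-injective to Fin-suc-injective)
open import Data.Bool using (Bool; true; false; T)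
open import Data.Maybe using (Maybe; just; nothing)
open import Data.Maybe.Properties using (just-injective; ≡-dec)
open import Data.Product using (Σ; ∃-syntax; _×_; _,_; proj₁; proj₂; uncurry)
open import Data.Sum using (_⊎_; inj₁; inj₂)
open import Data.Empty using (⊥-elim)
open import Function using (_∘_)
open import Function.Bundles using (_⇔_; mk⇔; module Equivalence)
open import Relation.Nullary using (¬_; yes; no)
open import Relation.Nullary.Decidable using (⌊_⌋; fromWitness; toWitness)
open import Relation.Binary using (tri<; tri≈; tri>)
open import Relation.Binary.PropositionalEquality
open import Algebra.Properties.Semiring.Sum +-*-semiring
  using (sum-syntax; ∑-comm; ∑-distrib-+; *-distribˡ-sum)

∑-mono-≤ : ∀ {k} {f g : Fin k → ℕ} → (∀ i → f i ≤ g i) → ∑[ i < k ] f i ≤ ∑[ i < k ] g i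
∑-mono-≤ {zero} f≤g = z≤n
∑-mono-≤ {suc k} f≤g = +-mono-≤ (f≤g zero) (∑-mono-≤ (f≤g ∘ suc))

∑-const : ∀ k c → ∑[ i < k ] c ≡ k * c
∑-const zero c = refl
∑-const (suc k) c = cong (c +_) (∑-const k c)

∑-single-≤ : ∀ {k} (f : Fin k → ℕ) {b} → (∀ i → f i ≤ b) →
  (∀ i j → 0 < f i → 0 < f j → i ≡ j) → ∑[ i < k ] f i ≤ b
∑-single-≤ {zero} f f≤b unique = z≤n
∑-single-≤ {suc k} f {b} f≤b unique with f zero in eq
... | zero = ∑-single-≤ (f ∘ suc) (f≤b ∘ suc)
               (λ i j fi>0 fj>0 → Fin-suc-injective (unique (suc i) (suc j) fi>0 fj>0))
... | suc x = begin
  suc x + ∑[ i < k ] f (suc i) ≤⟨ +-monoʳ-≤ (suc x) (∑-mono-≤ rest-zero) ⟩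
  suc x + ∑[ i < k ] 0         ≡⟨ cong (suc x +_) (trans (∑-const k 0) (*-zeroʳ k)) ⟩
  suc x + 0                    ≡⟨ +-identityʳ (suc x) ⟩
  suc x                        ≡⟨ eq ⟨
  f zero                       ≤⟨ f≤b zero ⟩
  b                            ∎
  where
  open ≤-Reasoning
  rest-zero : ∀ i → f (suc i) ≤ 0
  rest-zero i with f (suc i) in eq′
  ... | zero = z≤n
  ... | suc _ with () ← unique zero (suc i) (subst (0 <_) (sym eq) (s≤s z≤n)) (subst (0 <_) (sym eq′) (s≤s z≤n))

2^-∣ : ∀ {a b} → a ≤ b → 2 ^ a ∣ 2 ^ b
2^-∣ {a} {b} a≤b = subst (2 ^ a ∣_) 2^a*2^[b-a]≡2^b (m∣m*n (2 ^ (b ∸ a)))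
  where
  2^a*2^[b-a]≡2^b : 2 ^ a * 2 ^ (b ∸ a) ≡ 2 ^ b
  2^a*2^[b-a]≡2^b = trans (sym (^-distribˡ-+-* 2 a (b ∸ a))) (cong (2 ^_) (m+[n∸m]≡n a≤b))

2^-cancel-≤ : ∀ {a b} → 2 ^ a ≤ 2 ^ b → a ≤ b
2^-cancel-≤ {a} {b} 2^a≤2^b with a ≤? b
... | yes a≤b = a≤b
... | no a≰b = ⊥-elim (<⇒≱ (^-monoʳ-< 2 (s≤s (s≤s z≤n)) (≰⇒> a≰b)) 2^a≤2^b)

n<2^n : ∀ n → n < 2 ^ n
n<2^n zero = s≤s z≤n
n<2^n (suc n) = begin-strict
  suc n           ≡⟨ +-comm 1 n ⟩
  n + 1           <⟨ +-mono-<-≤ (n<2^n n) (m^n>0 2 n) ⟩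
  2 ^ n + 2 ^ n   ≡⟨ cong (2 ^ n +_) (+-identityʳ (2 ^ n)) ⟨
  2 ^ suc n       ∎
  where open ≤-Reasoning

searchExp : (fuel e x : ℕ) → ℕ
searchExp zero e x = e
searchExp (suc fuel) e x with x ≤? 2 ^ e
... | yes _ = e
... | no _ = searchExp fuel (suc e) x

searchExp-spec : ∀ fuel e x → 2 ^ e ≤ suc (2 * x) → x ≤ 2 ^ (e + fuel) →
  (x ≤ 2 ^ searchExp fuel e x) × (2 ^ searchExp fuel e x ≤ suc (2 * x))
searchExp-spec zero e x 2^e≤ x≤ = subst (λ z → x ≤ 2 ^ z) (+-identityʳ e) x≤ , 2^e≤
searchExp-spec (suc fuel) e x 2^e≤ x≤ with x ≤? 2 ^ e
... | yes x≤2^e = x≤2^e , 2^e≤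
... | no x≰2^e = searchExp-spec fuel (suc e) x 2^[1+e]≤ (subst (λ z → x ≤ 2 ^ z) (+-suc e fuel) x≤)
  where
  2^[1+e]≤ : 2 ^ suc e ≤ suc (2 * x)
  2^[1+e]≤ = m≤n⇒m≤1+n (*-monoʳ-≤ 2 (<⇒≤ (≰⇒> x≰2^e)))

ceilLog₂ : ℕ → ℕ
ceilLog₂ x = searchExp x 0 x

ceilLog₂-spec : ∀ x → (x ≤ 2 ^ ceilLog₂ x) × (2 ^ ceilLog₂ x ≤ suc (2 * x))
ceilLog₂-spec x = searchExp-spec x 0 x (s≤s z≤n) (<⇒≤ (n<2^n x))

-- The half-open interval [lo, hi).
record Interval : Set where
  constructor [_,_⟩
  field
    lo hi : ℕ

_⊆_ : Interval → Interval → Set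
[ a , b ⟩ ⊆ [ a′ , b′ ⟩ = (a′ ≤ a) × (b ≤ b′)

Apart : Interval → Interval → Set
Apart [ a , b ⟩ [ a′ , b′ ⟩ = (b ≤ a′) ⊎ (b′ ≤ a)

NonEmpty : Interval → Set
NonEmpty [ a , b ⟩ = a < b

apart-⊆ : ∀ {I J I′ J′} → I′ ⊆ I → J′ ⊆ J → Apart I J → Apart I′ J′
apart-⊆ (_ , hi) (lo′ , _) (inj₁ I≤J) = inj₁ (≤-trans hi (≤-trans I≤J lo′))
apart-⊆ (lo , _) (_ , hi′) (inj₂ J≤I) = inj₂ (≤-trans hi′ (≤-trans J≤I lo))

apart-irrefl : ∀ {I} → NonEmpty I → ¬ Apart I I
apart-irrefl a<b (inj₁ b≤a) = <⇒≱ a<b b≤a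
apart-irrefl a<b (inj₂ b≤a) = <⇒≱ a<b b≤a

⊆-apart-⊥ : ∀ {I J K} → NonEmpty I → I ⊆ J → I ⊆ K → ¬ Apart J K
⊆-apart-⊥ ne I⊆J I⊆K J-K = apart-irrefl ne (apart-⊆ I⊆J I⊆K J-K)

block : ℕ → ℕ → Interval
block e s = [ s , s + 2 ^ e ⟩

block-nonEmpty : ∀ e s → NonEmpty (block e s)
block-nonEmpty e s = m<m+n s (m^n>0 2 e)

block-⊆-exp : ∀ {e s e′ s′} → block e s ⊆ block e′ s′ → e ≤ e′
block-⊆-exp {e} {s} {e′} {s′} (s′≤s , hi≤) =
  2^-cancel-≤ (+-cancelˡ-≤ s′ (2 ^ e) (2 ^ e′) (≤-trans (+-monoˡ-≤ (2 ^ e) s′≤s) hi≤))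

block-offset-⊆ : ∀ {c e s e′} → s + 2 ^ e ≤ 2 ^ e′ → block e (c + s) ⊆ block e′ c
block-offset-⊆ {c} {e} {s} {e′} fits =
  m≤m+n c s , subst (_≤ c + 2 ^ e′) (sym (+-assoc c s (2 ^ e))) (+-monoʳ-≤ c fits)

apart-offset : ∀ c {e s e′ s′} → Apart (block e s) (block e′ s′) → Apart (block e (c + s)) (block e′ (c + s′))
apart-offset c {e} {s} {e′} {s′} (inj₁ le) = inj₁ (subst (_≤ c + s′) (sym (+-assoc c s (2 ^ e))) (+-monoʳ-≤ c le))
apart-offset c {e} {s} {e′} {s′} (inj₂ le) = inj₂ (subst (_≤ c + s) (sym (+-assoc c s′ (2 ^ e′))) (+-monoʳ-≤ c le))

module _ (e : ℕ) where
  private instance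
    2^e-nonZero : NonZero (2 ^ e)
    2^e-nonZero = m^n≢0 2 e

  alignUp : ℕ → ℕ
  alignUp c = ((c + pred (2 ^ e)) / 2 ^ e) * 2 ^ e

  alignUp-∣ : ∀ c → 2 ^ e ∣ alignUp c
  alignUp-∣ c = n∣m*n ((c + pred (2 ^ e)) / 2 ^ e)

  ≤-alignUp : ∀ c → c ≤ alignUp c
  ≤-alignUp c = +-cancelʳ-≤ (pred (2 ^ e)) c (alignUp c) (begin
    c + pred (2 ^ e)                  ≡⟨ m≡m%n+[m/n]*n (c + pred (2 ^ e)) (2 ^ e) ⟩
    (c + pred (2 ^ e)) % 2 ^ e + alignUp c ≤⟨ +-monoˡ-≤ (alignUp c) remainder≤ ⟩
    pred (2 ^ e) + alignUp c          ≡⟨ +-comm (pred (2 ^ e)) (alignUp c) ⟩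
    alignUp c + pred (2 ^ e)          ∎)
    where
    open ≤-Reasoning
    remainder≤ : (c + pred (2 ^ e)) % 2 ^ e ≤ pred (2 ^ e)
    remainder≤ = ≤-pred (subst ((c + pred (2 ^ e)) % 2 ^ e <_) (sym (suc-pred (2 ^ e))) (m%n<n (c + pred (2 ^ e)) (2 ^ e)))

  alignUp-+-≤ : ∀ c → alignUp c + 2 ^ e ≤ c + 2 * 2 ^ e
  alignUp-+-≤ c = begin
    alignUp c + 2 ^ e                   ≤⟨ +-monoˡ-≤ (2 ^ e) (m/n*n≤m (c + pred (2 ^ e)) (2 ^ e)) ⟩
    c + pred (2 ^ e) + 2 ^ e            ≤⟨ +-monoˡ-≤ (2 ^ e) (+-monoʳ-≤ c pred[n]≤n) ⟩
    c + 2 ^ e + 2 ^ e                   ≡⟨ +-assoc c (2 ^ e) (2 ^ e) ⟩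
    c + (2 ^ e + 2 ^ e)                 ≡⟨ cong (λ z → c + (2 ^ e + z)) (+-identityʳ (2 ^ e)) ⟨
    c + 2 * 2 ^ e                       ∎
    where open ≤-Reasoning

selectedSize : Bool → ℕ → ℕ
selectedSize true e = 2 ^ e
selectedSize false e = 0

selectedSize-≤ : ∀ b e → selectedSize b e ≤ 2 ^ e
selectedSize-≤ true e = ≤-refl
selectedSize-≤ false e = z≤n

selectedSize-selected : ∀ {b e} → 0 < selectedSize b e → T b
selectedSize-selected {true} _ = _

after : Bool → ℕ → ℕ → ℕ
after true e c = alignUp e c + 2 ^ e
after false e c = c

-- Items i of Fin k with sel i = true are packed in index order starting at c, each as a block
-- of length 2 ^ e i at the first multiple of its length after the previous block:
-- packStart gives the position of each block and packEnd the end of the whole packing.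
packEnd : ∀ {k} → (Fin k → Bool) → (Fin k → ℕ) → ℕ → ℕ
packEnd {zero} sel e c = c
packEnd {suc k} sel e c = packEnd (sel ∘ suc) (e ∘ suc) (after (sel zero) (e zero) c)

packStart : ∀ {k} → (Fin k → Bool) → (Fin k → ℕ) → ℕ → Fin k → ℕ
packStart sel e c zero = alignUp (e zero) c
packStart sel e c (suc i) = packStart (sel ∘ suc) (e ∘ suc) (after (sel zero) (e zero) c) i

≤-after : ∀ b e c → c ≤ after b e c
≤-after true e c = ≤-trans (≤-alignUp e c) (m≤m+n _ _)
≤-after false e c = ≤-refl

after-≤ : ∀ b e c → after b e c ≤ c + 2 * selectedSize b e
after-≤ true e c = alignUp-+-≤ e c
after-≤ false e c = m≤m+n c _

≤-packEnd : ∀ {k} (sel : Fin k → Bool) e c → c ≤ packEnd sel e c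
≤-packEnd {zero} sel e c = ≤-refl
≤-packEnd {suc k} sel e c = ≤-trans (≤-after (sel zero) (e zero) c) (≤-packEnd (sel ∘ suc) (e ∘ suc) _)

packEnd-≤ : ∀ {k} (sel : Fin k → Bool) e c → packEnd sel e c ≤ c + 2 * ∑[ i < k ] selectedSize (sel i) (e i)
packEnd-≤ {zero} sel e c = m≤m+n c _
packEnd-≤ {suc k} sel e c = begin
  packEnd (sel ∘ suc) (e ∘ suc) (after (sel zero) (e zero) c)   ≤⟨ packEnd-≤ (sel ∘ suc) (e ∘ suc) _ ⟩
  after (sel zero) (e zero) c + 2 * rest                        ≤⟨ +-monoˡ-≤ (2 * rest) (after-≤ (sel zero) (e zero) c) ⟩
  c + 2 * first + 2 * rest                                      ≡⟨ +-assoc c (2 * first) (2 * rest) ⟩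
  c + (2 * first + 2 * rest)                                    ≡⟨ cong (c +_) (*-distribˡ-+ 2 first rest) ⟨
  c + 2 * (first + rest)                                        ∎
  where
  open ≤-Reasoning
  first = selectedSize (sel zero) (e zero)
  rest = ∑[ i < k ] selectedSize (sel (suc i)) (e (suc i))

≤-packStart : ∀ {k} (sel : Fin k → Bool) e c i → c ≤ packStart sel e c i
≤-packStart sel e c zero = ≤-alignUp (e zero) c
≤-packStart sel e c (suc i) = ≤-trans (≤-after (sel zero) (e zero) c) (≤-packStart (sel ∘ suc) (e ∘ suc) _ i)

packStart-∣ : ∀ {k} (sel : Fin k → Bool) e c i → 2 ^ e i ∣ packStart sel e c i
packStart-∣ sel e c zero = alignUp-∣ (e zero) c
packStart-∣ sel e c (suc i) = packStart-∣ (sel ∘ suc) (e ∘ suc) _ i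

packStart-fits : ∀ {k} (sel : Fin k → Bool) e c i → T (sel i) → packStart sel e c i + 2 ^ e i ≤ packEnd sel e c
packStart-fits sel e c zero selected with sel zero
... | true = ≤-packEnd (sel ∘ suc) (e ∘ suc) _
packStart-fits sel e c (suc i) selected = packStart-fits (sel ∘ suc) (e ∘ suc) _ i selected

packStart-apart : ∀ {k} (sel : Fin k → Bool) e c {i j} → T (sel i) → T (sel j) → i ≢ j →
  Apart (block (e i) (packStart sel e c i)) (block (e j) (packStart sel e c j))
packStart-apart sel e c {zero} {zero} _ _ i≢j = ⊥-elim (i≢j refl)
packStart-apart sel e c {zero} {suc j} selected _ _ with sel zero
... | true = inj₁ (≤-packStart (sel ∘ suc) (e ∘ suc) _ j)
packStart-apart sel e c {suc i} {zero} _ selected _ with sel zero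
... | true = inj₂ (≤-packStart (sel ∘ suc) (e ∘ suc) _ i)
packStart-apart sel e c {suc i} {suc j} sel-i sel-j i≢j =
  packStart-apart (sel ∘ suc) (e ∘ suc) _ sel-i sel-j (i≢j ∘ cong suc)

-- A block [s, s + 2^e) with 2^e ∣ s is encoded by the number 2s + 2^e.  Since 2^e is the
-- exact power of two dividing the code, the code determines the block.
code : ℕ → ℕ → ℕ
code e s = 2 * s + 2 ^ e

code-< : ∀ M e s → s + 2 ^ e ≤ M → code e s < suc (2 * M)
code-< M e s s+2^e≤M = s≤s (begin
  2 * s + 2 ^ e         ≤⟨ +-monoʳ-≤ (2 * s) (m≤m+n (2 ^ e) (2 ^ e + 0)) ⟩
  2 * s + 2 * 2 ^ e     ≡⟨ *-distribˡ-+ 2 s (2 ^ e) ⟨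
  2 * (s + 2 ^ e)       ≤⟨ *-monoʳ-≤ 2 s+2^e≤M ⟩
  2 * M                 ∎)
  where open ≤-Reasoning

-- If e < e′ then 2^(e+1) divides code e′ s′ but not code e s.
code-exp-< : ∀ {e e′ s s′} → e < e′ → 2 ^ e ∣ s → 2 ^ e′ ∣ s′ → code e s ≢ code e′ s′
code-exp-< {e} {e′} {s} {s′} e<e′ 2^e∣s 2^e′∣s′ codes≡ = <⇒≱ 2^e<2^[1+e] (∣⇒≤ {{m^n≢0 2 e}} 2^[1+e]∣2^e)
  where
  2^e<2^[1+e] : 2 ^ e < 2 ^ suc e
  2^e<2^[1+e] = ^-monoʳ-< 2 (s≤s (s≤s z≤n)) (n<1+n e)
  2^[1+e]∣code′ : 2 ^ suc e ∣ code e′ s′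
  2^[1+e]∣code′ = ∣m∣n⇒∣m+n (∣-trans (2^-∣ e<e′) (∣-trans 2^e′∣s′ (n∣m*n 2))) (2^-∣ e<e′)
  2^[1+e]∣2^e : 2 ^ suc e ∣ 2 ^ e
  2^[1+e]∣2^e = ∣m+n∣m⇒∣n (subst (2 ^ suc e ∣_) (sym codes≡) 2^[1+e]∣code′) (*-monoʳ-∣ 2 2^e∣s)

code-injective : ∀ e s e′ s′ → 2 ^ e ∣ s → 2 ^ e′ ∣ s′ → code e s ≡ code e′ s′ → (e ≡ e′) × (s ≡ s′)
code-injective e s e′ s′ 2^e∣s 2^e′∣s′ codes≡ with <-cmp e e′
... | tri< e<e′ _ _ = ⊥-elim (code-exp-< e<e′ 2^e∣s 2^e′∣s′ codes≡)
... | tri> _ _ e>e′ = ⊥-elim (code-exp-< e>e′ 2^e′∣s′ 2^e∣s (sym codes≡))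
... | tri≈ _ refl _ = refl , *-cancelˡ-≡ s s′ 2 (+-cancelʳ-≡ (2 ^ e) (2 * s) (2 * s′) codes≡)

CodesNested : ℕ → ℕ → Set
CodesNested c c′ = ∃[ e ] ∃[ s ] ∃[ e′ ] ∃[ s′ ]
  (c ≡ code e s) × (c′ ≡ code e′ s′) × (2 ^ e ∣ s) × (2 ^ e′ ∣ s′) × (block e′ s′ ⊆ block e s)

codesNested-⊆ : ∀ e s e′ s′ → 2 ^ e ∣ s → 2 ^ e′ ∣ s′ → CodesNested (code e s) (code e′ s′) → block e′ s′ ⊆ block e s
codesNested-⊆ e s e′ s′ 2^e∣s 2^e′∣s′ (x , y , x′ , y′ , c≡ , c′≡ , 2^x∣y , 2^x′∣y′ , nested)
  with code-injective e s x y 2^e∣s 2^x∣y c≡ | code-injective e′ s′ x′ y′ 2^e′∣s′ 2^x′∣y′ c′≡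
... | refl , refl | refl , refl = nested

-- Number of codes of aligned blocks inside [0, M).
codes : ℕ → ℕ
codes M = suc (2 * M)

Link : ∀ L M → Fin L × Fin (codes M) → Fin L × Fin (codes M) → Set
Link L M (i , c) (j , c′) = (toℕ j ≡ suc (toℕ i)) × CodesNested (toℕ c) (toℕ c′)

U : ∀ L M → Graph (L * codes M)
U L M = record
  { Adj = λ x y → Link L M (remQuot (codes M) x) (remQuot (codes M) y) ⊎ Link L M (remQuot (codes M) y) (remQuot (codes M) x)
  ; sym = λ { (inj₁ l) → inj₂ l ; (inj₂ l) → inj₁ l }
  ; irrefl = λ { (inj₁ (level≡ , _)) → 1+n≢n (sym level≡) ; (inj₂ (level≡ , _)) → 1+n≢n (sym level≡) }
  }

record IntervalModel {m d} (F : Forest m d) (L M : ℕ) : Set where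
  field
    level exp start : Fin m → ℕ
    level-< : ∀ u → level u < L
    aligned : ∀ u → 2 ^ exp u ∣ start u
    bounded : ∀ u → start u + 2 ^ exp u ≤ M
    root-level : ∀ {r} → parent F r ≡ nothing → level r ≡ 0
    child-level : ∀ {u v} → parent F v ≡ just u → level v ≡ suc (level u)
    child-inside : ∀ {u v} → parent F v ≡ just u → block (exp v) (start v) ⊆ block (exp u) (start u)
    level-apart : ∀ {u u′} → level u ≡ level u′ → u ≢ u′ → Apart (block (exp u) (start u)) (block (exp u′) (start u′))

module Embedding {m d L M} {F : Forest m d} (model : IntervalModel F L M) where
  open IntervalModel model

  nodeBlock : Fin m → Interval
  nodeBlock u = block (exp u) (start u)

  vertex : Fin m → Fin L × Fin (codes M)
  vertex u = fromℕ< (level-< u) , fromℕ< (code-< M (exp u) (start u) (bounded u))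

  φ : Fin m → Fin (L * codes M)
  φ = uncurry combine ∘ vertex

  vertex-level : ∀ u → toℕ (proj₁ (vertex u)) ≡ level u
  vertex-level u = toℕ-fromℕ< (level-< u)

  vertex-code : ∀ u → toℕ (proj₂ (vertex u)) ≡ code (exp u) (start u)
  vertex-code u = toℕ-fromℕ< (code-< M (exp u) (start u) (bounded u))

  -- Distinct nodes with equal level and block would be apart from themselves.
  vertex-injective : ∀ {u u′} → vertex u ≡ vertex u′ → u ≡ u′
  vertex-injective {u} {u′} same with u ≟ᶠ u′
  ... | yes u≡u′ = u≡u′
  ... | no u≢u′ with code-injective (exp u) (start u) (exp u′) (start u′) (aligned u) (aligned u′) codes≡
    where
    codes≡ : code (exp u) (start u) ≡ code (exp u′) (start u′)
    codes≡ = trans (sym (vertex-code u)) (trans (cong (toℕ ∘ proj₂) same) (vertex-code u′))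
  ... | exp≡ , start≡ = ⊥-elim (apart-irrefl (block-nonEmpty (exp u) (start u))
          (subst (Apart (nodeBlock u)) (sym (cong₂ block exp≡ start≡)) (level-apart levels≡ u≢u′)))
    where
    levels≡ : level u ≡ level u′
    levels≡ = trans (sym (vertex-level u)) (trans (cong (toℕ ∘ proj₁) same) (vertex-level u′))

  -- If v lies one level below u inside u's block then u is v's parent: otherwise v's parent
  -- would be a different node on u's level whose block is apart from u's yet contains v's.
  parent-of-nested : ∀ {u v} → level v ≡ suc (level u) → nodeBlock v ⊆ nodeBlock u → parent F v ≡ just u
  parent-of-nested {u} {v} level≡ v⊆u with parent F v in pv
  ... | nothing = ⊥-elim (1+n≢0 (trans (sym level≡) (root-level pv)))
  ... | just w with w ≟ᶠ u
  ...   | yes refl = refl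
  ...   | no w≢u = ⊥-elim (⊆-apart-⊥ (block-nonEmpty (exp v) (start v)) (child-inside pv) v⊆u
                      (level-apart (suc-injective (trans (sym (child-level pv)) level≡)) w≢u))

  link⇔parent : ∀ {u v} → Link L M (vertex u) (vertex v) ⇔ (parent F v ≡ just u)
  link⇔parent {u} {v} = mk⇔ to from
    where
    to : Link L M (vertex u) (vertex v) → parent F v ≡ just u
    to (level≡ , nested) = parent-of-nested
      (trans (sym (vertex-level v)) (trans level≡ (cong suc (vertex-level u))))
      (codesNested-⊆ (exp u) (start u) (exp v) (start v) (aligned u) (aligned v)
        (subst₂ CodesNested (vertex-code u) (vertex-code v) nested))
    from : parent F v ≡ just u → Link L M (vertex u) (vertex v)
    from pv = trans (vertex-level v) (trans (child-level pv) (cong suc (sym (vertex-level u)))) ,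
      (exp u , start u , exp v , start v , vertex-code u , vertex-code v , aligned u , aligned v , child-inside pv)

  embedding : IsInducedSubgraph (ForestAdj F) (U L M)
  embedding = φ , φ-injective , λ u v → adjacency u v
    where
    remQuot-φ : ∀ u → remQuot (codes M) (φ u) ≡ vertex u
    remQuot-φ u = remQuot-combine (proj₁ (vertex u)) (proj₂ (vertex u))
    φ-injective : ∀ {u u′} → φ u ≡ φ u′ → u ≡ u′
    φ-injective {u} {u′} φ≡ = vertex-injective (trans (sym (remQuot-φ u)) (trans (cong (remQuot (codes M)) φ≡) (remQuot-φ u′)))
    adj-φ : ∀ u v → Adj (U L M) (φ u) (φ v) ≡ (Link L M (vertex u) (vertex v) ⊎ Link L M (vertex v) (vertex u))
    adj-φ u v = cong₂ (λ x y → Link L M x y ⊎ Link L M y x) (remQuot-φ u) (remQuot-φ v)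
    adjacency : ∀ u v → ForestAdj F u v ⇔ Adj (U L M) (φ u) (φ v)
    adjacency u v = subst (ForestAdj F u v ⇔_) (sym (adj-φ u v)) (mk⇔
      (λ { (inj₁ pu) → inj₂ (Equivalence.from link⇔parent pu) ; (inj₂ pv) → inj₁ (Equivalence.from link⇔parent pv) })
      (λ { (inj₁ l) → inj₂ (Equivalence.to link⇔parent l) ; (inj₂ l) → inj₁ (Equivalence.to link⇔parent l) }))

-- Each node u
-- receives a block of length 2 ^ expAt h u, where h = D - depth budgets the height of the
-- subtree below u; its children are packed greedily into that block, the roots into [0, M).
module Layout (D : ℕ) {m : ℕ} (F : Forest m (suc D)) where
  p : ParentMap m
  p = parent F

  -- childOf q i: the parent of i is q (so childOf nothing selects the roots).
  childOf : Maybe (Fin m) → Fin m → Bool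
  childOf q i = ⌊ ≡-dec _≟ᶠ_ (p i) q ⌋

  childOf-complete : ∀ {q i} → p i ≡ q → T (childOf q i)
  childOf-complete {q} {i} = fromWitness {a? = ≡-dec _≟ᶠ_ (p i) q}

  expAt : ℕ → Fin m → ℕ
  expAt zero u = 0
  expAt (suc h) u = ceilLog₂ (packEnd (childOf (just u)) (expAt h) 0)

  offset : Maybe (Fin m) → ℕ → Fin m → ℕ
  offset q h = packStart (childOf q) (expAt h) 0

  levelAt : ∀ {k u} → DepthAtMost p k u → ℕ
  levelAt {suc k} (inj₁ _) = 0
  levelAt {suc k} (inj₂ (_ , _ , a)) = suc (levelAt a)

  startAt : ∀ {k u} → DepthAtMost p k u → ℕ
  startAt {suc k} {u} (inj₁ _) = offset nothing D u
  startAt {suc k} {u} (inj₂ (w , _ , a)) = startAt a + offset (just w) (D ∸ suc (levelAt a)) u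

  levelAt-< : ∀ {k u} (a : DepthAtMost p k u) → levelAt a < k
  levelAt-< {suc k} (inj₁ _) = s≤s z≤n
  levelAt-< {suc k} (inj₂ (_ , _ , a)) = s≤s (levelAt-< a)

  placeAt-irrelevant : ∀ {k k′ u} (a : DepthAtMost p k u) (b : DepthAtMost p k′ u) →
    (levelAt a ≡ levelAt b) × (startAt a ≡ startAt b)
  placeAt-irrelevant {suc k} {suc k′} (inj₁ _) (inj₁ _) = refl , refl
  placeAt-irrelevant {suc k} {suc k′} (inj₁ pu) (inj₂ (_ , pu′ , _)) with () ← trans (sym pu) pu′
  placeAt-irrelevant {suc k} {suc k′} (inj₂ (_ , pu , _)) (inj₁ pu′) with () ← trans (sym pu) pu′
  placeAt-irrelevant {suc k} {suc k′} {u} (inj₂ (w , pu , a)) (inj₂ (w′ , pu′ , b))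
    with refl ← just-injective (trans (sym pu) pu′)
    with levels≡ , starts≡ ← placeAt-irrelevant a b =
    cong suc levels≡ , cong₂ (λ l s → s + offset (just w) (D ∸ suc l) u) levels≡ starts≡

  level start exp : Fin m → ℕ
  level u = levelAt (depth≤ F u)
  start u = startAt (depth≤ F u)
  exp u = expAt (D ∸ level u) u

  nodeBlock : Fin m → Interval
  nodeBlock u = block (exp u) (start u)

  level-< : ∀ u → level u < suc D
  level-< u = levelAt-< (depth≤ F u)

  root-level : ∀ {r} → p r ≡ nothing → level r ≡ 0
  root-level {r} pr with depth≤ F r
  ... | inj₁ _ = refl
  ... | inj₂ (_ , pr′ , _) with () ← trans (sym pr) pr′

  root-start : ∀ {r} → p r ≡ nothing → start r ≡ offset nothing D r
  root-start {r} pr with depth≤ F r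
  ... | inj₁ _ = refl
  ... | inj₂ (_ , pr′ , _) with () ← trans (sym pr) pr′

  root-block : ∀ {r} → p r ≡ nothing → nodeBlock r ≡ block (expAt D r) (offset nothing D r)
  root-block {r} pr = cong₂ block (cong (λ l → expAt (D ∸ l) r) (root-level pr)) (root-start pr)

  child-place : ∀ {v w} → p v ≡ just w →
    (level v ≡ suc (level w)) × (start v ≡ start w + offset (just w) (D ∸ suc (level w)) v)
  child-place {v} {w} pv with depth≤ F v
  ... | inj₁ pv′ with () ← trans (sym pv) pv′
  ... | inj₂ (w′ , pv′ , a) with refl ← just-injective (trans (sym pv) pv′)
    with levels≡ , starts≡ ← placeAt-irrelevant a (depth≤ F w) =
    cong suc levels≡ , cong₂ (λ l s → s + offset (just w) (D ∸ suc l) v) levels≡ starts≡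

  child-level : ∀ {v w} → p v ≡ just w → level v ≡ suc (level w)
  child-level pv = proj₁ (child-place pv)

  childBudget : Fin m → ℕ
  childBudget w = D ∸ suc (level w)

  child-exp : ∀ {v w} → p v ≡ just w → exp v ≡ expAt (childBudget w) v
  child-exp {v} pv = cong (λ l → expAt (D ∸ l) v) (child-level pv)

  -- A parent has budget one more than its children, so its block holds their packing.
  parent-exp : ∀ {v w} → p v ≡ just w → exp w ≡ expAt (suc (childBudget w)) w
  parent-exp {v} {w} pv = cong (λ h → expAt h w) (budget≡ D (level w) level<D)
    where
    level<D : level w < D
    level<D = ≤-pred (subst (_< suc D) (child-level pv) (level-< v))
    budget≡ : ∀ n l → l < n → n ∸ l ≡ suc (n ∸ suc l)
    budget≡ (suc n) zero _ = refl
    budget≡ (suc n) (suc l) l<n = budget≡ n l (≤-pred l<n)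

  children-fit : ∀ {v w} → p v ≡ just w → packEnd (childOf (just w)) (expAt (childBudget w)) 0 ≤ 2 ^ exp w
  children-fit {v} {w} pv = subst (λ e → childrenEnd ≤ 2 ^ e) (sym (parent-exp pv)) (proj₁ (ceilLog₂-spec childrenEnd))
    where childrenEnd = packEnd (childOf (just w)) (expAt (childBudget w)) 0

  child-block : ∀ {v w} → p v ≡ just w →
    nodeBlock v ≡ block (expAt (childBudget w) v) (start w + offset (just w) (childBudget w) v)
  child-block pv = cong₂ block (child-exp pv) (proj₂ (child-place pv))

  child-inside : ∀ {v w} → p v ≡ just w → nodeBlock v ⊆ nodeBlock w
  child-inside {v} {w} pv = subst (_⊆ nodeBlock w) (sym (child-block pv))
    (block-offset-⊆ {start w} {expAt (childBudget w) v} {offset (just w) (childBudget w) v} {exp w}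
      (≤-trans (packStart-fits (childOf (just w)) _ 0 v (childOf-complete pv)) (children-fit pv)))

  root-or-child : ∀ v → (p v ≡ nothing) ⊎ ∃[ w ] (p v ≡ just w)
  root-or-child v with p v
  ... | nothing = inj₁ refl
  ... | just w = inj₂ (w , refl)

  parent-induction : (P : Fin m → Set) → (∀ {r} → p r ≡ nothing → P r) →
    (∀ {v w} → p v ≡ just w → P w → P v) → ∀ u → P u
  parent-induction P roots children u = along (depth≤ F u)
    where
    along : ∀ {k u} → DepthAtMost p k u → P u
    along {suc k} (inj₁ pu) = roots pu
    along {suc k} (inj₂ (w , pu , a)) = children pu (along a)

  aligned : ∀ u → 2 ^ exp u ∣ start u
  aligned = parent-induction _ root child
    where
    root : ∀ {r} → p r ≡ nothing → 2 ^ exp r ∣ start r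
    root {r} pr = subst₂ (λ e s → 2 ^ e ∣ s) (cong (λ l → expAt (D ∸ l) r) (sym (root-level pr))) (sym (root-start pr))
      (packStart-∣ (childOf nothing) (expAt D) 0 r)
    -- The child's length divides the parent's length, hence the parent's start, and its offset.
    child : ∀ {v w} → p v ≡ just w → 2 ^ exp w ∣ start w → 2 ^ exp v ∣ start v
    child {v} {w} pv 2^w∣start = subst (2 ^ exp v ∣_) (sym (proj₂ (child-place pv)))
      (∣m∣n⇒∣m+n (∣-trans (2^-∣ (block-⊆-exp {exp v} {start v} {exp w} {start w} (child-inside pv))) 2^w∣start)
                  (subst (λ e → 2 ^ e ∣ offset (just w) (childBudget w) v) (sym (child-exp pv))
                     (packStart-∣ (childOf (just w)) _ 0 v)))

  -- Blocks of distinct nodes on a common level are apart: siblings by the packing, cousins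
  -- because their parents' blocks already are.
  level-apart : ∀ {u u′} → level u ≡ level u′ → u ≢ u′ → Apart (nodeBlock u) (nodeBlock u′)
  level-apart {u} {u′} = parent-induction ApartFromLevel root child u u′
    where
    ApartFromLevel : Fin m → Set
    ApartFromLevel u = ∀ u′ → level u ≡ level u′ → u ≢ u′ → Apart (nodeBlock u) (nodeBlock u′)
    root : ∀ {r} → p r ≡ nothing → ApartFromLevel r
    root {r} pr r′ levels≡ r≢r′ with root-or-child r′
    ... | inj₂ (_ , pr′) = ⊥-elim (1+n≢0 (trans (sym (child-level pr′)) (trans (sym levels≡) (root-level pr))))
    ... | inj₁ pr′ = subst₂ Apart (sym (root-block pr)) (sym (root-block pr′))
      (packStart-apart (childOf nothing) (expAt D) 0 (childOf-complete pr) (childOf-complete pr′) r≢r′)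
    child : ∀ {v w} → p v ≡ just w → ApartFromLevel w → ApartFromLevel v
    child {v} {w} pv w-apart v′ levels≡ v≢v′ with root-or-child v′
    ... | inj₁ pv′ = ⊥-elim (1+n≢0 (trans (sym (child-level pv)) (trans levels≡ (root-level pv′))))
    ... | inj₂ (w′ , pv′) with w ≟ᶠ w′
    ...   | yes refl = subst₂ Apart (sym (child-block pv)) (sym (child-block pv′))
      (apart-offset (start w) {expAt (childBudget w) v} {_} {expAt (childBudget w) v′}
        (packStart-apart (childOf (just w)) _ 0 (childOf-complete pv) (childOf-complete pv′) v≢v′))
    ...   | no w≢w′ = apart-⊆ (child-inside pv) (child-inside pv′) (w-apart w′ parents≡ w≢w′)
      where
      parents≡ : level w ≡ level w′
      parents≡ = suc-injective (trans (sym (child-level pv)) (trans levels≡ (child-level pv′)))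

  rootsEnd : ℕ
  rootsEnd = packEnd (childOf nothing) (expAt D) 0

  bounded : ∀ {M} → rootsEnd ≤ M → ∀ u → start u + 2 ^ exp u ≤ M
  bounded {M} fits = parent-induction _ root child
    where
    root : ∀ {r} → p r ≡ nothing → start r + 2 ^ exp r ≤ M
    root {r} pr = subst (_≤ M) (cong (λ I → Interval.hi I) (sym (root-block pr)))
      (≤-trans (packStart-fits (childOf nothing) (expAt D) 0 r (childOf-complete pr)) fits)
    child : ∀ {v w} → p v ≡ just w → start w + 2 ^ exp w ≤ M → start v + 2 ^ exp v ≤ M
    child pv = ≤-trans (proj₂ (child-inside pv))

  model : ∀ M → rootsEnd ≤ M → IntervalModel F (suc D) M
  model M fits = record
    { level = level ; exp = exp ; start = start
    ; level-< = level-< ; aligned = aligned ; bounded = bounded fits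
    ; root-level = root-level ; child-level = child-level ; child-inside = child-inside
    ; level-apart = level-apart }

  childrenSize : ℕ → Fin m → ℕ
  childrenSize h u = ∑[ i < m ] selectedSize (childOf (just u) i) (expAt h i)

  totalSize : ℕ → ℕ
  totalSize h = ∑[ u < m ] (2 ^ expAt h u)

  -- Every node is a child of at most one node, so the children sizes add up to at most the total.
  ∑childrenSize-≤ : ∀ h → ∑[ u < m ] childrenSize h u ≤ totalSize h
  ∑childrenSize-≤ h = begin
    ∑[ u < m ] ∑[ i < m ] size u i   ≡⟨ ∑-comm size ⟩
    ∑[ i < m ] ∑[ u < m ] size u i   ≤⟨ ∑-mono-≤ (λ i → ∑-single-≤ (λ u → size u i)
                                          (λ u → selectedSize-≤ (childOf (just u) i) (expAt h i)) (one-parent i)) ⟩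
    totalSize h                      ∎
    where
    open ≤-Reasoning
    size : Fin m → Fin m → ℕ
    size u i = selectedSize (childOf (just u) i) (expAt h i)
    parent-of : ∀ {u i} → 0 < size u i → p i ≡ just u
    parent-of {u} {i} counted = toWitness {a? = ≡-dec _≟ᶠ_ (p i) (just u)} (selectedSize-selected counted)
    one-parent : ∀ i u u′ → 0 < size u i → 0 < size u′ i → u ≡ u′
    one-parent i u u′ counted counted′ = just-injective (trans (sym (parent-of counted)) (parent-of counted′))

  size-step : ∀ h u → 2 ^ expAt (suc h) u ≤ suc (2 * (2 * childrenSize h u))
  size-step h u = ≤-trans (proj₂ (ceilLog₂-spec childrenEnd))
    (s≤s (*-monoʳ-≤ 2 (packEnd-≤ (childOf (just u)) (expAt h) 0)))
    where childrenEnd = packEnd (childOf (just u)) (expAt h) 0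

  totalSize-≤ : ∀ h → totalSize h ≤ 5 ^ h * m
  totalSize-≤ zero = ≤-reflexive (trans (∑-const m 1) (*-comm m 1))
  totalSize-≤ (suc h) = begin
    totalSize (suc h)                                     ≤⟨ ∑-mono-≤ (size-step h) ⟩
    ∑[ u < m ] (1 + 2 * (2 * childrenSize h u))           ≡⟨ ∑-distrib-+ (λ _ → 1) (λ u → 2 * (2 * childrenSize h u)) ⟩
    ∑[ u < m ] 1 + ∑[ u < m ] (2 * (2 * childrenSize h u))   ≡⟨ cong₂ _+_ (∑-const m 1) pull-out ⟩
    m * 1 + 2 * (2 * ∑[ u < m ] childrenSize h u)         ≤⟨ +-mono-≤ m*1≤y (*-monoʳ-≤ 2 (*-monoʳ-≤ 2 children≤y)) ⟩
    y + 2 * (2 * y)                                       ≡⟨ cong (y +_) (*-assoc 2 2 y) ⟨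
    5 * y                                                 ≡⟨ *-assoc 5 (5 ^ h) m ⟨
    5 ^ suc h * m                                         ∎
    where
    open ≤-Reasoning
    y = 5 ^ h * m
    pull-out : ∑[ u < m ] (2 * (2 * childrenSize h u)) ≡ 2 * (2 * ∑[ u < m ] childrenSize h u)
    pull-out = sym (trans (cong (2 *_) (*-distribˡ-sum 2 (childrenSize h))) (*-distribˡ-sum 2 (λ u → 2 * childrenSize h u)))
    m*1≤y : m * 1 ≤ y
    m*1≤y = ≤-trans (≤-reflexive (*-identityʳ m)) (m≤n*m m (5 ^ h) {{m^n≢0 5 h}})
    children≤y : ∑[ u < m ] childrenSize h u ≤ y
    children≤y = ≤-trans (∑childrenSize-≤ h) (totalSize-≤ h)

  rootsEnd-≤ : rootsEnd ≤ 2 * 5 ^ D * m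
  rootsEnd-≤ = begin
    rootsEnd                                                    ≤⟨ packEnd-≤ (childOf nothing) (expAt D) 0 ⟩
    2 * ∑[ i < m ] selectedSize (childOf nothing i) (expAt D i) ≤⟨ *-monoʳ-≤ 2 (∑-mono-≤ (λ i → selectedSize-≤ (childOf nothing i) (expAt D i))) ⟩
    2 * totalSize D                                             ≤⟨ *-monoʳ-≤ 2 (totalSize-≤ D) ⟩
    2 * (5 ^ D * m)                                             ≡⟨ *-assoc 2 (5 ^ D) m ⟨
    2 * 5 ^ D * m                                               ∎
    where open ≤-Reasoning

universe-size : ∀ L a n → 1 ≤ n → L * codes (a * n) ≤ L * suc (2 * a) * n
universe-size L a n 1≤n = begin
  L * suc (2 * (a * n))       ≤⟨ *-monoʳ-≤ L (+-monoˡ-≤ (2 * (a * n)) 1≤n) ⟩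
  L * (n + 2 * (a * n))       ≡⟨ cong (λ x → L * (n + x)) (*-assoc 2 a n) ⟨
  L * (suc (2 * a) * n)       ≡⟨ *-assoc L (suc (2 * a)) n ⟨
  L * suc (2 * a) * n         ∎
  where open ≤-Reasoning

universal : ∀ D n → Universal n (suc D) (U (suc D) (2 * 5 ^ D * n))
universal D n m m≤n F = Embedding.embedding (Layout.model D F (2 * 5 ^ D * n) roots-fit)
  where
  roots-fit : Layout.rootsEnd D F ≤ 2 * 5 ^ D * n
  roots-fit = ≤-trans (Layout.rootsEnd-≤ D F) (*-monoʳ-≤ (2 * 5 ^ D) m≤n)

corollary1 : ∀ (d : ℕ) → 1 ≤ d → Σ ℕ (λ C → ∀ (n : ℕ) → 1 ≤ n → Σ ℕ (λ N → (N ≤ C * n) × Σ (Graph N) (λ U → Universal n d U)))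
corollary1 zero ()
corollary1 (suc D) _ = suc D * suc (2 * a) , λ n 1≤n →
  suc D * codes (a * n) , universe-size (suc D) a n 1≤n , U (suc D) (a * n) , universal D n
  where
  a : ℕ
  a = 2 * 5 ^ D
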